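{- With $u_1=(0000001111)$, $u_2=(0000110011)$, $v_1=(0000010111)$, $v_2=(0000100111)$, $v_3=(0001000111)$, $v_4=(0010000111)$, $v_5=(0100000111)$, $v_6=(1000000111)$, $w_1=(0000011011)$, $w_2=(0000011101)$, $w_3=(0000011110)$ in $\{0,1\}^{10}$, let $U_1 = \{0_{10},u_1,u_2\}$, $U_2=\{0_{10},u_1,v_1,\dots,v_6\}$, $U_3=\{0_{10},u_1,v_1,w_1,w_2,w_3\}$, $W=\{v : \|v\|\le 2\}$ and $T=\{v\in\{0,1\}^{10}: \|v-s\|\le 4\ \forall s\in U_1\}$. For each $C\in\{T,\ U_2\cup W,\ U_3\cup W\}$, the graph on $C$ in which two vertices are adjacent iff their Hamming distance is exactly $4$ has chromatic number at most $11$.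
   Context: $\|w\| = \sum_i |w_i|$; $\|u-v\|$ is the Hamming distance. -}

module Defs where

open import Data.Bool using (Bool; true; false; _xor_)
open import Data.Nat using (ℕ; zero; suc; _+_; _≤_)
open import Data.Fin using (Fin)
open import Data.Vec using (Vec; []; _∷_; zipWith; replicate)
open import Data.List using (List; []; _∷_)
open import Data.List.Membership.Propositional using (_∈_)
open import Data.Product using (Σ; _×_; proj₁)
open import Data.Sum using (_⊎_)
open import Relation.Binary.PropositionalEquality using (_≡_; _≢_)

Word : Set
Word = Vec Bool 10

bit : Bool → ℕ
bit true  = 1
bit false = 0

weight : ∀ {n} → Vec Bool n → ℕ
weight []       = 0
weight (b ∷ bs) = bit b + weight bs

-- Hamming distance ‖u - v‖ (over {0,1}, |u_i - v_i| = u_i xor v_i)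
dist : ∀ {n} → Vec Bool n → Vec Bool n → ℕ
dist u v = weight (zipWith _xor_ u v)

private
  O I : Bool
  O = false
  I = true

zero₁₀ : Word
zero₁₀ = replicate 10 false

u₁ u₂ v₁ v₂ v₃ v₄ v₅ v₆ w₁ w₂ w₃ : Word
u₁ = O ∷ O ∷ O ∷ O ∷ O ∷ O ∷ I ∷ I ∷ I ∷ I ∷ []
u₂ = O ∷ O ∷ O ∷ O ∷ I ∷ I ∷ O ∷ O ∷ I ∷ I ∷ []
v₁ = O ∷ O ∷ O ∷ O ∷ O ∷ I ∷ O ∷ I ∷ I ∷ I ∷ []
v₂ = O ∷ O ∷ O ∷ O ∷ I ∷ O ∷ O ∷ I ∷ I ∷ I ∷ []
v₃ = O ∷ O ∷ O ∷ I ∷ O ∷ O ∷ O ∷ I ∷ I ∷ I ∷ []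
v₄ = O ∷ O ∷ I ∷ O ∷ O ∷ O ∷ O ∷ I ∷ I ∷ I ∷ []
v₅ = O ∷ I ∷ O ∷ O ∷ O ∷ O ∷ O ∷ I ∷ I ∷ I ∷ []
v₆ = I ∷ O ∷ O ∷ O ∷ O ∷ O ∷ O ∷ I ∷ I ∷ I ∷ []
w₁ = O ∷ O ∷ O ∷ O ∷ O ∷ I ∷ I ∷ O ∷ I ∷ I ∷ []
w₂ = O ∷ O ∷ O ∷ O ∷ O ∷ I ∷ I ∷ I ∷ O ∷ I ∷ []
w₃ = O ∷ O ∷ O ∷ O ∷ O ∷ I ∷ I ∷ I ∷ I ∷ O ∷ []

U₁ U₂ U₃ : List Word
U₁ = zero₁₀ ∷ u₁ ∷ u₂ ∷ []
U₂ = zero₁₀ ∷ u₁ ∷ v₁ ∷ v₂ ∷ v₃ ∷ v₄ ∷ v₅ ∷ v₆ ∷ []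
U₃ = zero₁₀ ∷ u₁ ∷ v₁ ∷ w₁ ∷ w₂ ∷ w₃ ∷ []

Subset : Set₁
Subset = Word → Set

inList : List Word → Subset
inList L v = v ∈ L

_∪_ : Subset → Subset → Subset
(A ∪ B) v = A v ⊎ B v

W : Subset
W v = weight v ≤ 2

T : Subset
T v = ∀ s → s ∈ U₁ → dist v s ≤ 4

Vertex : Subset → Set
Vertex C = Σ Word C

Adjacent : (C : Subset) → Vertex C → Vertex C → Set
Adjacent C x y = dist (proj₁ x) (proj₁ y) ≡ 4

ChromaticAtMost : ℕ → (C : Subset) → Set
ChromaticAtMost k C =
  Σ (Vertex C → Fin k) λ c → ∀ x y → Adjacent C x y → c x ≢ c y

-- A proper colouring of a graph is the same as a cover of its vertices by independent
-- sets. For each of the three sets C we exhibit 11, 9 and 8 lists of words respectively,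
-- none containing two words at Hamming distance 4, that together contain every element
-- of C. Both properties are decidable over the 2^10 words of length 10, so they are
-- verified by evaluation.
module Submission where

open import Defs
open import Data.Bool using (Bool; true; false)
open import Data.Bool.Properties using () renaming (_≟_ to _≟ᵇ_)
open import Data.Nat using (ℕ; zero; suc; _≤_; _≤?_; _/_; _%_; _≡ᵇ_)
open import Data.Nat.Properties using (m≤m+n) renaming (_≟_ to _≟ℕ_)
open import Data.Fin using (Fin; inject≤)
open import Data.Fin.Properties using (inject≤-injective)
open import Data.Product using (_×_; _,_)
open import Data.Vec using (Vec; []; _∷_; _∷ʳ_; lookup)
open import Data.Vec.Properties using (≡-dec)
open import Data.Vec.Relation.Unary.All as VecAll using () renaming (All to AllOf)
open import Data.Vec.Relation.Unary.All.Properties using (lookup⁺)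
open import Data.Vec.Relation.Unary.Any as VecAny using (index) renaming (Any to AnyOf)
open import Data.Vec.Relation.Unary.Any.Properties using (lookup-index)
open import Data.List using (List; []; _∷_; _++_; map; filter)
open import Data.List.Relation.Unary.All as All using (All; all?)
open import Data.List.Relation.Unary.Any using (here)
open import Data.List.Membership.Propositional using (_∈_)
open import Data.List.Membership.Propositional.Properties using (∈-++⁺ˡ; ∈-++⁺ʳ; ∈-map⁺; ∈-filter⁺)
open import Data.List.Membership.DecPropositional (≡-dec {n = 10} _≟ᵇ_) using (_∈?_)
open import Relation.Nullary using (Dec; ¬_; ¬?)
open import Relation.Nullary.Decidable using (True; toWitness; map′; _×-dec_; _⊎-dec_)
open import Relation.Unary using (Decidable)
open import Relation.Binary.PropositionalEquality using (_≡_; refl; sym; subst)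

allVecs : ∀ n → List (Vec Bool n)
allVecs zero    = [] ∷ []
allVecs (suc n) = map (false ∷_) (allVecs n) ++ map (true ∷_) (allVecs n)

∈-allVecs : ∀ {n} (v : Vec Bool n) → v ∈ allVecs n
∈-allVecs []          = here refl
∈-allVecs (false ∷ v) = ∈-++⁺ˡ (∈-map⁺ (false ∷_) (∈-allVecs v))
∈-allVecs {suc n} (true ∷ v) =
  ∈-++⁺ʳ (map (false ∷_) (allVecs n)) (∈-map⁺ (true ∷_) (∈-allVecs v))

∀-by-enumeration : ∀ {n} {P Q : Vec Bool n → Set} (P? : Decidable P) →
                   All Q (filter P? (allVecs n)) → ∀ v → P v → Q v
∀-by-enumeration P? qs v pv = All.lookup qs (∈-filter⁺ P? (∈-allVecs v) pv)

T? : Decidable T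
T? v = map′ (λ near s → All.lookup near) (λ t → All.tabulate (t _))
            (all? (λ s → dist v s ≤? 4) U₁)

inList-∪-W? : (L : List Word) → Decidable (inList L ∪ W)
inList-∪-W? L v = (v ∈? L) ⊎-dec (weight v ≤? 2)

Independent : List Word → Set
Independent S = All (λ u → All (λ v → ¬ dist u v ≡ 4) S) S

independent? : Decidable Independent
independent? S = all? (λ u → all? (λ v → ¬? (dist u v ≟ℕ 4)) S) S

colourClasses⇒chromaticAtMost : ∀ {k C} (classes : Vec (List Word) k) →
  AllOf Independent classes → (∀ v → C v → AnyOf (v ∈_) classes) → ChromaticAtMost k C
colourClasses⇒chromaticAtMost {k} {C} classes independent cover = colour , proper
  where
  colour : Vertex C → Fin k
  colour (v , cv) = index (cover v cv)

  proper : ∀ x y → Adjacent C x y → ¬ colour x ≡ colour y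
  proper (u , cu) (v , cv) d≡4 same =
    All.lookup (All.lookup (lookup⁺ independent (colour (u , cu))) u∈) v∈ d≡4
    where
    u∈ : u ∈ lookup classes (colour (u , cu))
    u∈ = lookup-index (cover u cu)
    v∈ : v ∈ lookup classes (colour (u , cu))
    v∈ = subst (λ i → v ∈ lookup classes i) (sym same) (lookup-index (cover v cv))

ColourClassesOf : ∀ {k} {C : Subset} → Decidable C → Vec (List Word) k → Set
ColourClassesOf C? classes =
  AllOf Independent classes × All (λ v → AnyOf (v ∈_) classes) (filter C? (allVecs 10))

colourClassesOf? : ∀ {k} {C : Subset} (C? : Decidable C) (classes : Vec (List Word) k) →
                   Dec (ColourClassesOf C? classes)
colourClassesOf? C? classes =
  VecAll.all? independent? classes ×-dec all? (λ v → VecAny.any? (v ∈?_) classes) _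

chromaticAtMost-by-evaluation : ∀ {k} {C : Subset} (C? : Decidable C)
  (classes : Vec (List Word) k) → {True (colourClassesOf? C? classes)} → ChromaticAtMost k C
chromaticAtMost-by-evaluation C? classes {checked} with toWitness checked
... | independent , covered =
  colourClasses⇒chromaticAtMost classes independent (∀-by-enumeration C? covered)

chromaticAtMost-mono : ∀ {j k} {C : Subset} → j ≤ k → ChromaticAtMost j C → ChromaticAtMost k C
chromaticAtMost-mono j≤k (colour , proper) =
  (λ x → inject≤ (colour x) j≤k) ,
  λ x y adj same → proper x y adj (inject≤-injective j≤k j≤k (colour x) (colour y) same)

-- word n has the decimal digits of n as its bits: word 1111 is 0000001111.
word : ℕ → Word
word = digits 10
  where
  digits : ∀ k → ℕ → Vec Bool k
  digits zero    _ = []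
  digits (suc k) n = digits k (n / 10) ∷ʳ (n % 10 ≡ᵇ 1)

words : List ℕ → List Word
words = map word

colourClassesT : Vec (List Word) 11
colourClassesT =
    words (11 ∷ 111 ∷ 10011 ∷ 10101 ∷ 10110 ∷ 100001 ∷ 100010 ∷ 100111 ∷ 101011 ∷ 110011 ∷
           1100011 ∷ 10100011 ∷ 100100011 ∷ 1000100011 ∷ [])
  ∷ words (0 ∷ 101 ∷ 1001 ∷ 1011 ∷ 10001 ∷ 100011 ∷ 101001 ∷ 101010 ∷ 1000001 ∷ 10000001 ∷
           100000001 ∷ 1000000001 ∷ [])
  ∷ words (1010 ∷ 1111 ∷ 11001 ∷ 11010 ∷ 11011 ∷ 1001011 ∷ 10001011 ∷ 100001011 ∷ 1000001011 ∷
           [])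
  ∷ words (100101 ∷ 100110 ∷ 111100 ∷ 1000010 ∷ 1000111 ∷ 1010011 ∷ 11000011 ∷ 101000011 ∷
           1001000011 ∷ [])
  ∷ words (1 ∷ 10 ∷ 10100 ∷ 10111 ∷ 11101 ∷ 110101 ∷ 1000011 ∷ 1010101 ∷ 1101010 ∷ 10000011 ∷
           10010101 ∷ 10101010 ∷ 100000011 ∷ 100010101 ∷ 100101010 ∷ 1000000011 ∷ 1000010101 ∷
           1000101010 ∷ [])
  ∷ words (110 ∷ 100100 ∷ 101110 ∷ 110110 ∷ 1011001 ∷ 1100110 ∷ 10011001 ∷ 10100110 ∷
           100011001 ∷ 100100110 ∷ 1000011001 ∷ 1000100110 ∷ [])
  ∷ words (10010 ∷ 11000 ∷ 11110 ∷ 111010 ∷ 1011010 ∷ 1100101 ∷ 10011010 ∷ 10100101 ∷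
           100011010 ∷ 100100101 ∷ 1000011010 ∷ 1000100101 ∷ [])
  ∷ words (1101001 ∷ 10101001 ∷ 1000000010 ∷ 1000000111 ∷ 1000010011 ∷ 1100000011 ∷ [])
  ∷ words (100000010 ∷ 100000111 ∷ 100010011 ∷ 100010110 ∷ 1000101001 ∷ [])
  ∷ words (10000010 ∷ 10000111 ∷ 10010011 ∷ 110000011 ∷ 1010000011 ∷ [])
  ∷ words (101000 ∷ 101101 ∷ 111001 ∷ 1010110 ∷ 10010110 ∷ 100101001 ∷ 1000010110 ∷ [])
  ∷ []

colourClassesU₂W : Vec (List Word) 9
colourClassesU₂W =
    words (0 ∷ 1 ∷ 10 ∷ 11 ∷ 100 ∷ 101 ∷ 1000 ∷ 1001 ∷ 10000 ∷ 10001 ∷ 100000 ∷ 100001 ∷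
           1000000 ∷ 1000001 ∷ 10000000 ∷ 10000001 ∷ 100000000 ∷ 100000001 ∷ 1000000000 ∷
           1000000001 ∷ [])
  ∷ words (110 ∷ 1010 ∷ 10010 ∷ 100010 ∷ 1000010 ∷ 10000010 ∷ 100000010 ∷ 1000000010 ∷ [])
  ∷ words (1100 ∷ 10100 ∷ 100100 ∷ 1000100 ∷ 10000100 ∷ 100000100 ∷ 1000000100 ∷ [])
  ∷ words (1000001000 ∷ 1000010000 ∷ 1000100000 ∷ 1001000000 ∷ 1010000000 ∷ 1100000000 ∷ [])
  ∷ words (1001000 ∷ 1010000 ∷ 1100000 ∷ 11000000 ∷ 101000000 ∷ 1000000111 ∷ [])
  ∷ words (1000111 ∷ 10001000 ∷ 10010000 ∷ 10100000 ∷ 110000000 ∷ [])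
  ∷ words (11000 ∷ 100111 ∷ 10000111 ∷ 100001000 ∷ 100010000 ∷ [])
  ∷ words (101000 ∷ 110000 ∷ 100100000 ∷ [])
  ∷ words (1111 ∷ 10111 ∷ 100000111 ∷ [])
  ∷ []

colourClassesU₃W : Vec (List Word) 8
colourClassesU₃W =
    words (0 ∷ 1 ∷ 10 ∷ 100 ∷ 101 ∷ 110 ∷ 1000 ∷ 1100 ∷ 10000 ∷ 10100 ∷ 100000 ∷ 100100 ∷
           1000000 ∷ 1000100 ∷ 10000000 ∷ 10000100 ∷ 100000000 ∷ 100000100 ∷ 1000000000 ∷
           1000000100 ∷ [])
  ∷ words (11110 ∷ 100001 ∷ 1000001 ∷ 10000001 ∷ 100000001 ∷ 1000000001 ∷ [])
  ∷ words (10001 ∷ 10010 ∷ 11000 ∷ 110000 ∷ 1010000 ∷ 10010000 ∷ 100010000 ∷ 1000010000 ∷ [])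
  ∷ words (1001 ∷ 1010 ∷ 101000 ∷ 1001000 ∷ 10001000 ∷ 100001000 ∷ 1000001000 ∷ [])
  ∷ words (11 ∷ 100010 ∷ 1000010 ∷ 10000010 ∷ 100000010 ∷ 1000000010 ∷ [])
  ∷ words (1111 ∷ 10111 ∷ 11011 ∷ 11101 ∷ 11000000 ∷ 101000000 ∷ 110000000 ∷ [])
  ∷ words (1100000 ∷ 10100000 ∷ 100100000 ∷ 1000100000 ∷ [])
  ∷ words (1001000000 ∷ 1010000000 ∷ 1100000000 ∷ [])
  ∷ []

proposition7 : ChromaticAtMost 11 T
    × ChromaticAtMost 11 (inList U₂ ∪ W)
    × ChromaticAtMost 11 (inList U₃ ∪ W)
proposition7 =
  chromaticAtMost-by-evaluation T? colourClassesT ,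
  chromaticAtMost-mono (m≤m+n 9 2)
    (chromaticAtMost-by-evaluation (inList-∪-W? U₂) colourClassesU₂W) ,
  chromaticAtMost-mono (m≤m+n 8 3)
    (chromaticAtMost-by-evaluation (inList-∪-W? U₃) colourClassesU₃W)
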